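{- Let $k\in\mathbb{N}_0$, let $A=(a_1,\dots,a_k)$, $B=(b_1,\dots,b_k)\in\mathbb{N}^k$ with $\gcd(a_i,b_j)=1$ for all $i,j$, for $1\le i\le k$ let $f_i\in\mathbb{C}[x]$ be separable of degree $b_i$, let $A_k=\{(x_0,\dots,x_k)\in\mathbb{C}^{k+1}: x_i^{a_i}=f_i(x_{i-1}),\ 1\le i\le k\}$ have no singular points, and let $C_k$ be its nonsingular projective model, of genus at least $2$, with unique point at infinity $P_\infty^k$. If $h_1,h_2$ are two $A$-reduced monomials with the same pole order at $P_\infty^k$, then $h_1=h_2$.
   Context: A monomial $x_0^{e_0}x_1^{e_1}\cdots x_k^{e_k}$ is $A$-reduced if $e_0\ge0$ and $0\le e_i<a_i$ for $1\le i\le k$. The pole order of $x_i$ at $P_\infty^k$ is $g_i=b_1\cdots b_ia_{i+1}\cdots a_k$, so the monomial $x_0^{e_0}\cdots x_k^{e_k}$ has pole order $\sum_ie_ig_i$ there. -}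

module Defs where

open import Data.Nat using (ℕ; _*_; _<_; _<ᵇ_) renaming (suc to 1+)
open import Data.Fin using (Fin; toℕ; suc)
open import Data.List using (map; allFin)
open import Data.Nat.ListAction using (sum; product)
open import Data.Bool using (if_then_else_)

-- Indices: a, b : Fin k → ℕ, where index j : Fin k stands for the paper's
-- index j+1 (so a j = a_{j+1}, b j = b_{j+1}).
-- Exponent vectors e : Fin (1+ k) → ℕ, e i = e_i for i = 0..k.

-- g_i = b_1 ⋯ b_i · a_{i+1} ⋯ a_k : the paper's index m = toℕ j + 1
-- contributes b_m if m ≤ i (i.e. toℕ j < toℕ i), else a_m.
poleGen : (k : ℕ) → (Fin k → ℕ) → (Fin k → ℕ) → Fin (1+ k) → ℕ
poleGen k a b i =
  product (map (λ j → if toℕ j <ᵇ toℕ i then b j else a j) (allFin k))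

poleOrder : (k : ℕ) → (Fin k → ℕ) → (Fin k → ℕ) → (Fin (1+ k) → ℕ) → ℕ
poleOrder k a b e =
  sum (map (λ i → e i * poleGen k a b i) (allFin (1+ k)))

-- A-reduced: e_0 ≥ 0 (automatic in ℕ) and 0 ≤ e_m < a_m for 1 ≤ m ≤ k
AReduced : (k : ℕ) → (Fin k → ℕ) → (Fin (1+ k) → ℕ) → Set
AReduced k a e = (j : Fin k) → e (suc j) < a j

-- The pole orders g₀, …, g_k satisfy g_i = g'_i · a_k for i < k and g_k = b_1 ⋯ b_k, where g'
-- are the pole orders of the tower of height k − 1. A pole order is therefore X · a_k + e_k · ∏ b
-- with 0 ≤ e_k < a_k, and since a_k is coprime to ∏ b such a representation is unique. This
-- recovers e_k and the pole order of the truncated monomial, and induction on k does the rest.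
module Submission where

open import Defs
open import Data.Nat using (ℕ; suc; _<_)
open import Data.Nat.GCD using (gcd)
open import Data.Fin using (Fin)
open import Relation.Binary.PropositionalEquality using (_≡_)

open import Data.Bool using (Bool; true; false; if_then_else_)
open import Data.Fin using (zero; toℕ; inject₁; fromℕ)
import Data.Fin as Fin
open import Data.Fin.Properties using (toℕ-inject₁)
open import Data.List as List using (map; allFin)
open import Data.List.Properties using (map-tabulate)
open import Data.Nat using (zero; _+_; _*_; _<ᵇ_; NonZero; >-nonZero)
open import Data.Nat.Coprimality using (Coprime; gcd≡1⇒coprime; coprime-divisor)
open import Data.Nat.Divisibility using (_∣_; ∣-trans; ∣1⇒≡1; n∣m*n; ∣m+n∣m⇒∣n; >⇒∤)
open import Data.Nat.ListAction using (sum; product)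
open import Data.Nat.Properties
open import Data.Product using (_×_; _,_; proj₁; proj₂)
open import Data.Sum using (inj₁; inj₂)
open import Data.Vec.Functional as Vector using (Vector; init; last)
open import Function using (_∘_; id)
open import Relation.Binary.PropositionalEquality
  using (refl; sym; trans; cong; cong₂; subst; module ≡-Reasoning)
open import Relation.Nullary using (contradiction)

open import Algebra.Properties.Semiring.Sum +-*-semiring
  using (sum-init-last; sum-cong-≗; *-distribʳ-sum) renaming (sum to ∑)
open import Algebra.Properties.Monoid.Sum *-1-monoid
  using () renaming (sum to ∏; sum-init-last to ∏-init-last; sum-cong-≗ to ∏-cong-≗)

∀-init-last : ∀ {n} {P : Fin (suc n) → Set} → P (fromℕ n) → (∀ i → P (inject₁ i)) → ∀ i → P i
∀-init-last {zero}  p-last p-init zero        = p-last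
∀-init-last {suc n} p-last p-init zero        = p-init zero
∀-init-last {suc n} p-last p-init (Fin.suc i) = ∀-init-last p-last (p-init ∘ Fin.suc) i

fromℕ-≮ᵇ-inject₁ : ∀ n (i : Fin (suc n)) → (toℕ (fromℕ n) <ᵇ toℕ (inject₁ i)) ≡ false
fromℕ-≮ᵇ-inject₁ zero    zero        = refl
fromℕ-≮ᵇ-inject₁ (suc n) zero        = refl
fromℕ-≮ᵇ-inject₁ (suc n) (Fin.suc i) = fromℕ-≮ᵇ-inject₁ n i

<ᵇ-fromℕ : ∀ n (j : Fin n) → (toℕ j <ᵇ toℕ (fromℕ n)) ≡ true
<ᵇ-fromℕ (suc n) zero        = refl
<ᵇ-fromℕ (suc n) (Fin.suc j) = <ᵇ-fromℕ n j

inject₁-<ᵇ-inject₁ : ∀ {m n} (j : Fin m) (i : Fin n) →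
                     (toℕ (inject₁ j) <ᵇ toℕ (inject₁ i)) ≡ (toℕ j <ᵇ toℕ i)
inject₁-<ᵇ-inject₁ j i = cong₂ _<ᵇ_ (toℕ-inject₁ j) (toℕ-inject₁ i)

if-cong : ∀ {a} {A : Set a} {c d : Bool} (x y : A) → c ≡ d → (if c then x else y) ≡ (if d then x else y)
if-cong x y = cong (λ c → if c then x else y)

foldr-tabulate : ∀ {a b} {A : Set a} {B : Set b} (f : A → B → B) (z : B) {n} (g : Vector A n) →
                 List.foldr f z (List.tabulate g) ≡ Vector.foldr f z g
foldr-tabulate f z {zero}  g = refl
foldr-tabulate f z {suc n} g = cong (f (g zero)) (foldr-tabulate f z (g ∘ Fin.suc))

sum-map-allFin : ∀ n (g : Vector ℕ n) → sum (map g (allFin n)) ≡ ∑ g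
sum-map-allFin n g = trans (cong sum (map-tabulate id g)) (foldr-tabulate _+_ 0 g)

product-map-allFin : ∀ n (g : Vector ℕ n) → product (map g (allFin n)) ≡ ∏ g
product-map-allFin n g = trans (cong product (map-tabulate id g)) (foldr-tabulate _*_ 1 g)

module _ {k : ℕ} (a b : Vector ℕ (suc k)) where

  poleGen-inject₁ : ∀ i → poleGen (suc k) a b (inject₁ i) ≡ poleGen k (init a) (init b) i * last a
  poleGen-inject₁ i = begin
    poleGen (suc k) a b (inject₁ i)          ≡⟨ product-map-allFin (suc k) factor ⟩
    ∏ factor                                 ≡⟨ ∏-init-last factor ⟩
    ∏ (init factor) * last factor            ≡⟨ cong₂ _*_ (∏-cong-≗ factor-init) factor-last ⟩
    ∏ factor′ * last a                       ≡⟨ cong (_* last a) (product-map-allFin k factor′) ⟨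
    poleGen k (init a) (init b) i * last a   ∎
    where
    open ≡-Reasoning
    factor : Vector ℕ (suc k)
    factor j = if toℕ j <ᵇ toℕ (inject₁ i) then b j else a j
    factor′ : Vector ℕ k
    factor′ j = if toℕ j <ᵇ toℕ i then init b j else init a j
    factor-init : ∀ j → init factor j ≡ factor′ j
    factor-init j = if-cong (init b j) (init a j) (inject₁-<ᵇ-inject₁ j i)
    factor-last : last factor ≡ last a
    factor-last = if-cong (last b) (last a) (fromℕ-≮ᵇ-inject₁ k i)

poleGen-fromℕ : ∀ k (a b : Vector ℕ k) → poleGen k a b (fromℕ k) ≡ ∏ b
poleGen-fromℕ k a b = trans (product-map-allFin k _) (∏-cong-≗ (λ j → if-cong (b j) (a j) (<ᵇ-fromℕ k j)))

poleOrder-zero : ∀ (a b : Vector ℕ 0) e → poleOrder 0 a b e ≡ e zero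
poleOrder-zero a b e = trans (+-identityʳ _) (*-identityʳ _)

poleOrder-init-last : ∀ {k} (a b : Vector ℕ (suc k)) e →
  poleOrder (suc k) a b e ≡ poleOrder k (init a) (init b) (init e) * last a + last e * ∏ b
poleOrder-init-last {k} a b e = begin
  poleOrder (suc k) a b e                                    ≡⟨ sum-map-allFin (suc (suc k)) term ⟩
  ∑ term                                                     ≡⟨ sum-init-last term ⟩
  ∑ (init term) + last term                                  ≡⟨ cong₂ _+_ (sum-cong-≗ term-init) term-last ⟩
  ∑ (λ i → term′ i * last a) + last e * ∏ b                  ≡⟨ cong (_+ last e * ∏ b) (*-distribʳ-sum (last a) term′) ⟨
  ∑ term′ * last a + last e * ∏ b                            ≡⟨ cong (λ X → X * last a + last e * ∏ b) (sum-map-allFin (suc k) term′) ⟨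
  poleOrder k (init a) (init b) (init e) * last a + last e * ∏ b ∎
  where
  open ≡-Reasoning
  term : Vector ℕ (suc (suc k))
  term i = e i * poleGen (suc k) a b i
  term′ : Vector ℕ (suc k)
  term′ i = init e i * poleGen k (init a) (init b) i
  term-init : ∀ i → init term i ≡ term′ i * last a
  term-init i = trans (cong (init e i *_) (poleGen-inject₁ a b i)) (sym (*-assoc (init e i) _ _))
  term-last : last term ≡ last e * ∏ b
  term-last = cong (last e *_) (poleGen-fromℕ (suc k) a b)

coprime-* : ∀ {m n o} → Coprime m n → Coprime m o → Coprime m (n * o)
coprime-* m⊥n m⊥o {d} (d∣m , d∣no) = m⊥o (d∣m , coprime-divisor d⊥n d∣no)
  where
  d⊥n : Coprime d _
  d⊥n (c∣d , c∣n) = m⊥n (∣-trans c∣d d∣m , c∣n)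

coprime-∏ : ∀ {m n} (f : Vector ℕ n) → (∀ i → Coprime m (f i)) → Coprime m (∏ f)
coprime-∏ {n = zero}  f m⊥f (_ , d∣1) = ∣1⇒≡1 d∣1
coprime-∏ {n = suc n} f m⊥f = coprime-* (m⊥f zero) (coprime-∏ (f ∘ Fin.suc) (m⊥f ∘ Fin.suc))

-- Writing y = x + d, the equation gives X · A = Y · A + d · P, so A ∣ d · P, hence A ∣ d < A.
coprime-repr-≤ : ∀ {A P} X Y x d → Coprime A P → x + d < A →
                 X * A + x * P ≡ Y * A + (x + d) * P → d ≡ 0
coprime-repr-≤ X Y x zero _ _ _ = refl
coprime-repr-≤ {A} {P} X Y x d@(suc _) A⊥P x+d<A eq =
  contradiction A∣d (>⇒∤ (≤-<-trans (m≤n+m d x) x+d<A))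
  where
  open ≡-Reasoning
  XA≡YA+dP : X * A ≡ Y * A + d * P
  XA≡YA+dP = +-cancelʳ-≡ (x * P) _ _ (begin
    X * A + x * P             ≡⟨ eq ⟩
    Y * A + (x + d) * P       ≡⟨ cong (Y * A +_) (trans (*-distribʳ-+ P x d) (+-comm (x * P) (d * P))) ⟩
    Y * A + (d * P + x * P)   ≡⟨ +-assoc (Y * A) (d * P) (x * P) ⟨
    Y * A + d * P + x * P     ∎)
  A∣dP : A ∣ d * P
  A∣dP = ∣m+n∣m⇒∣n (subst (A ∣_) XA≡YA+dP (n∣m*n X)) (n∣m*n Y)
  A∣d : A ∣ d
  A∣d = coprime-divisor A⊥P (subst (A ∣_) (*-comm d P) A∣dP)

coprime-repr-unique : ∀ {A P} X Y x y .{{_ : NonZero A}} → Coprime A P → x < A → y < A →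
                      X * A + x * P ≡ Y * A + y * P → X ≡ Y × x ≡ y
coprime-repr-unique {A} {P} X Y x y A⊥P x<A y<A eq = X≡Y , x≡y
  where
  x≡y : x ≡ y
  x≡y with ≤-total x y
  ... | inj₁ x≤y with d , refl ← m≤n⇒∃[o]m+o≡n x≤y =
    sym (trans (cong (x +_) (coprime-repr-≤ X Y x d A⊥P y<A eq)) (+-identityʳ x))
  ... | inj₂ y≤x with d , refl ← m≤n⇒∃[o]m+o≡n y≤x =
    trans (cong (y +_) (coprime-repr-≤ Y X y d A⊥P x<A (sym eq))) (+-identityʳ y)
  X≡Y : X ≡ Y
  X≡Y = *-cancelʳ-≡ X Y A (+-cancelʳ-≡ (y * P) _ _ (trans (cong (λ z → X * A + z * P) (sym x≡y)) eq))

lemma5p3 : (k : ℕ) (a b : Fin k → ℕ) →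
    (∀ i → 0 < a i) → (∀ i → 0 < b i) →
    (∀ i j → gcd (a i) (b j) ≡ 1) →
    (e₁ e₂ : Fin (suc k) → ℕ) →
    AReduced k a e₁ → AReduced k a e₂ →
    poleOrder k a b e₁ ≡ poleOrder k a b e₂ →
    ∀ i → e₁ i ≡ e₂ i
lemma5p3 zero a b _ _ _ e₁ e₂ _ _ eq zero =
  trans (sym (poleOrder-zero a b e₁)) (trans eq (poleOrder-zero a b e₂))
lemma5p3 (suc k) a b a>0 b>0 a⊥b e₁ e₂ r₁ r₂ eq = ∀-init-last last-eq init-eq
  where
  instance
    last-a≢0 : NonZero (last a)
    last-a≢0 = >-nonZero (a>0 (fromℕ k))
  init-order-eq×last-eq : poleOrder k (init a) (init b) (init e₁) ≡ poleOrder k (init a) (init b) (init e₂)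
                        × last e₁ ≡ last e₂
  init-order-eq×last-eq = coprime-repr-unique _ _ (last e₁) (last e₂)
    (coprime-∏ b (gcd≡1⇒coprime ∘ a⊥b (fromℕ k))) (r₁ (fromℕ k)) (r₂ (fromℕ k))
    (trans (sym (poleOrder-init-last a b e₁)) (trans eq (poleOrder-init-last a b e₂)))
  last-eq : last e₁ ≡ last e₂
  last-eq = proj₂ init-order-eq×last-eq
  init-eq : ∀ i → init e₁ i ≡ init e₂ i
  init-eq = lemma5p3 k (init a) (init b) (a>0 ∘ inject₁) (b>0 ∘ inject₁) (λ i j → a⊥b (inject₁ i) (inject₁ j))
    (init e₁) (init e₂) (r₁ ∘ inject₁) (r₂ ∘ inject₁) (proj₁ init-order-eq×last-eq)
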